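{- Let $k\ge2$. For any online 1-bounded space $k$-cardinality constrained algorithm $ALG$ and any positive integer $m\ge3$, there exists an item sequence $I$ such that $OPT_k(I)=m$ and: (A) $ALG(I)\ge2\cdot OPT_k(I)-2$ if $k=2$; (B) $ALG(I)\ge\left(3-\frac2k\right)\cdot OPT_k(I)-5+\frac5k$ if $k\ge3$.
   Context: $k$-cardinality constrained bin packing: an input is $I=(a_1,\dots,a_n)\in(0,1]^n$; a feasible assignment is a map $f:\{1,\dots,n\}\to\mathbb{N}$ such that every bin has total size at most $1$ and contains at most $k$ items. $OPT_k(I)$ is the minimum number of non-empty bins of a feasible assignment; $ALG(I)$ is the number of non-empty bins of $ALG$'s output. A $k$-cardinality constrained algorithm always outputs a feasible assignment. An online algorithm processes the items in the given order, irrevocably assigning each item to a bin without seeing future items. A 1-bounded space algorithm has at most one open bin at a time: each item is packed into the latest opened bin or a newly opened bin, and earlier bins never receive items again. -}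

module Defs where

open import Data.Bool using (Bool; true; false; if_then_else_)
open import Data.Unit using (⊤)
open import Data.Nat as ℕ using (ℕ; zero; suc; _≡ᵇ_)
import Data.Nat.Properties as ℕₚ
open import Data.Rational as ℚ using (ℚ; 0ℚ; 1ℚ)
open import Data.List using (List; []; _∷_; _++_; [_]; length; map; filterᵇ; zip; foldr; deduplicate)
open import Data.Product using (_×_; _,_; proj₁; proj₂)
open import Relation.Binary.PropositionalEquality using (_≡_)

ValidInput : List ℚ → Set
ValidInput [] = ⊤
ValidInput (a ∷ as) = (0ℚ ℚ.< a) × (a ℚ.≤ 1ℚ) × ValidInput as

sumℚ : List ℚ → ℚ
sumℚ = foldr ℚ._+_ 0ℚ

-- An assignment f : {1..n} → ℕ is given as the list (f 1, ..., f n).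
-- Items (size, bin) placed in bin b:
itemsIn : List ℚ → List ℕ → ℕ → List ℚ
itemsIn I f b = map proj₁ (filterᵇ (λ p → proj₂ p ≡ᵇ b) (zip I f))

Feasible : ℕ → List ℚ → List ℕ → Set
Feasible k I f =
  (length f ≡ length I) ×
  ((b : ℕ) → (sumℚ (itemsIn I f b) ℚ.≤ 1ℚ) × (length (itemsIn I f b) ℕ.≤ k))

nonEmptyBins : List ℕ → ℕ
nonEmptyBins f = length (deduplicate ℕₚ._≟_ f)

OPTis : ℕ → List ℚ → ℕ → Set
OPTis k I m =
  (Data.Product.Σ (List ℕ) λ f → Feasible k I f × (nonEmptyBins f ≡ m)) ×
  ((f : List ℕ) → Feasible k I f → m ℕ.≤ nonEmptyBins f)
  where import Data.Product

-- A deterministic online 1-bounded-space algorithm is determined by its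
-- decision rule: given the items seen so far (in order) and the current
-- item, open a new bin (true) or put the item in the current open bin (false).
-- The first item always opens bin 0; bins are numbered 0,1,2,... in order of
-- opening, and a closed bin never receives items again.
OnlineAlg : Set
OnlineAlg = List ℚ → ℚ → Bool

-- run: history, index of current open bin, remaining items
runAlg : OnlineAlg → List ℚ → ℕ → List ℚ → List ℕ
runAlg A h b [] = []
runAlg A h b (x ∷ xs) =
  let b′ = if A h x then suc b else b in b′ ∷ runAlg A (h ++ [ x ]) b′ xs

algAssign : OnlineAlg → List ℚ → List ℕ
algAssign A [] = []
algAssign A (x ∷ xs) = 0 ∷ runAlg A [ x ] 0 xs

ALG : OnlineAlg → List ℚ → ℕ
ALG A I = nonEmptyBins (algAssign A I)

KConstrained : ℕ → OnlineAlg → Set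
KConstrained k A = (I : List ℚ) → ValidInput I → Feasible k I (algAssign A I)

{-# OPTIONS --safe #-}
-- All sizes are multiples of 1/D with D = k + 2ms and s = k − 1.  Bin j < m of the optimal
-- packing holds a large item (m + j)s + 1, a medium item (m − j)s + 1 and k − 2 tiny items of
-- size 1, which fill it exactly; fewer than m bins cannot hold the mk items, k per bin.
-- The input starts with the chain L₀ L₁ M₀ L₂ M₁ … L_{m−1} M_{m−2}, in which any two
-- consecutive items overflow a bin (their weights add up to more than 2m, and s > k − 2),
-- followed by M_{m−1} and the m(k − 2) tiny items.  A 1-bounded-space algorithm uses its bins
-- one after another, so it uses 1 + c bins when the labels change c times along the input.
-- The chain alone forces 2m − 2 changes, and a stretch of 1 + m(k − 2) items with c′ changes
-- meets at most 1 + c′ bins of at most k items each.  Hence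
-- k(ALG + 1) ≥ (2m − 1)k + m(k − 2) + 1, which gives both bounds.
module Submission where

open import Defs
open import Data.Nat using (ℕ; _+_; _*_; _∸_; _≤_)
open import Data.Rational using (ℚ)
open import Data.List using (List)
open import Data.Product using (Σ; _×_)
open import Relation.Binary.PropositionalEquality using (_≡_)

open import Data.Bool using (true; false; if_then_else_)
open import Data.Empty using (⊥-elim)
open import Data.Unit using (tt)
open import Data.Nat using (zero; suc; pred; _<_; z≤n; s≤s; z<s; _≡ᵇ_; _≟_; NonZero)
import Data.Nat.Properties as ℕ
open import Data.Nat.ListAction using (sum)
open import Data.Nat.ListAction.Properties using (sum-++; sum-↭)
open import Data.Nat.Tactic.RingSolver using (solve-∀)
import Data.Integer as ℤ
import Data.Integer.Properties as ℤ
import Data.Integer.Tactic.RingSolver as ℤ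
open import Data.Rational as ℚ using (0ℚ; 1ℚ; toℚᵘ)
import Data.Rational.Properties as ℚ
open import Data.Rational.Unnormalised as ℚᵘ using (mkℚᵘ; *≡*; *≤*)
import Data.Rational.Unnormalised.Properties as ℚᵘ
open import Data.List
  using ([]; _∷_; _++_; [_]; length; map; filter; filterᵇ; zip; replicate; deduplicate; upTo)
import Data.List.Properties as List
open import Data.List.Relation.Unary.All as All using (All; []; _∷_)
import Data.List.Relation.Unary.All.Properties as All
open import Data.List.Relation.Unary.Any using (here; there)
open import Data.List.Relation.Unary.Linked using (Linked; []; [-]; _∷_)
open import Data.List.Relation.Unary.Unique.Propositional using (Unique)
open import Data.List.Relation.Unary.AllPairs using (_∷_)
open import Data.List.Relation.Unary.Unique.DecPropositional.Properties using (deduplicate-!)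
open import Data.List.Membership.Propositional using (_∈_)
open import Data.List.Membership.Propositional.Properties
  using (∈-deduplicate⁺; ∈-deduplicate⁻; ∈-upTo⁺)
open import Data.List.Relation.Binary.Permutation.Propositional
  using (_↭_; ↭-refl; ↭-sym; ↭-trans; prep; swap; module PermutationReasoning)
open import Data.List.Relation.Binary.Permutation.Propositional.Properties
  using (↭-length; filter-↭; ++⁺ˡ; ++⁺ʳ; shifts; All-resp-↭)
import Data.List.Relation.Binary.Permutation.Propositional.Properties as ↭
open import Data.Product using (proj₁; proj₂; _,_; ∃₂)
open import Function using (_∘_; _⇔_; mk⇔; Equivalence)
open import Relation.Binary.PropositionalEquality
  using (_≢_; ≢-sym; refl; sym; trans; cong; cong₂; subst; subst₂; module ≡-Reasoning)
open import Relation.Nullary using (yes; no; proof; ofʸ; ofⁿ; ¬?)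
open import Relation.Nullary.Decidable using (T?)

private
  variable
    A B : Set
    b : ℕ
    l Ds : List ℕ

-- Bins of a list of labelled items

sizes : List (A × ℕ) → List A
sizes = map proj₁

labels : List (A × ℕ) → List ℕ
labels = map proj₂

-- Defs.itemsIn I f b is binOf b (zip I f) by definition.
binOf : ℕ → List (A × ℕ) → List A
binOf b Z = sizes (filterᵇ (λ z → proj₂ z ≡ᵇ b) Z)

binOf-++ : ∀ b (X Y : List (A × ℕ)) → binOf b (X ++ Y) ≡ binOf b X ++ binOf b Y
binOf-++ b []            Y = refl
binOf-++ b ((x , c) ∷ X) Y with c ≡ᵇ b
... | true  = cong (x ∷_) (binOf-++ b X Y)
... | false = binOf-++ b X Y

binOf-all : ∀ {S : List (A × ℕ)} → All (λ z → proj₂ z ≡ b) S → binOf b S ≡ sizes S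
binOf-all {b = b} S⊆b =
  cong sizes (List.filter-all (T? ∘ λ z → proj₂ z ≡ᵇ b) (All.map (ℕ.≡⇒≡ᵇ _ b) S⊆b))

binOf-none : ∀ {S : List (A × ℕ)} → All (λ z → proj₂ z ≢ b) S → binOf b S ≡ []
binOf-none {b = b} S∌b = cong sizes
  (List.filter-none (T? ∘ λ z → proj₂ z ≡ᵇ b) (All.map (λ c≢b → c≢b ∘ ℕ.≡ᵇ⇒≡ _ b) S∌b))

binOf-↭ : ∀ b {Z Z′ : List (A × ℕ)} → Z ↭ Z′ → binOf b Z ↭ binOf b Z′
binOf-↭ b Z↭Z′ = ↭.map⁺ proj₁ (filter-↭ (T? ∘ λ z → proj₂ z ≡ᵇ b) Z↭Z′)

binOf-zip-map : ∀ (g : A → B) b xs ys → binOf b (zip (map g xs) ys) ≡ map g (binOf b (zip xs ys))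
binOf-zip-map g b []       ys       = refl
binOf-zip-map g b (x ∷ xs) []       = refl
binOf-zip-map g b (x ∷ xs) (c ∷ ys) with c ≡ᵇ b
... | true  = cong (g x ∷_) (binOf-zip-map g b xs ys)
... | false = binOf-zip-map g b xs ys

zip-sizes-labels : ∀ (Z : List (A × ℕ)) → zip (sizes Z) (labels Z) ≡ Z
zip-sizes-labels []      = refl
zip-sizes-labels (z ∷ Z) = cong (z ∷_) (zip-sizes-labels Z)

sizes-zip : ∀ (xs : List A) ys → length xs ≡ length ys → sizes (zip xs ys) ≡ xs
sizes-zip []       []       _  = refl
sizes-zip (x ∷ xs) (_ ∷ ys) eq = cong (x ∷_) (sizes-zip xs ys (ℕ.suc-injective eq))

labels-zip : ∀ (xs : List A) ys → length xs ≡ length ys → labels (zip xs ys) ≡ ys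
labels-zip []       []       _  = refl
labels-zip (_ ∷ xs) (y ∷ ys) eq = cong (y ∷_) (labels-zip xs ys (ℕ.suc-injective eq))

length-zip : ∀ (xs : List A) ys → length xs ≡ length ys → length (zip xs ys) ≡ length xs
length-zip xs ys eq =
  trans (sym (List.length-map proj₁ (zip xs ys))) (cong length (sizes-zip xs ys eq))

map-++⁻ : ∀ (g : A → B) Z {xs ys} → map g Z ≡ xs ++ ys →
          ∃₂ λ X Y → Z ≡ X ++ Y × map g X ≡ xs × map g Y ≡ ys
map-++⁻ g Z       {[]}     eq = [] , Z , refl , refl , eq
map-++⁻ g (z ∷ Z) {x ∷ xs} eq with map-++⁻ g Z (List.∷-injectiveʳ eq)
... | X , Y , refl , gX≡xs , gY≡ys =
  z ∷ X , Y , refl , cong₂ _∷_ (List.∷-injectiveˡ eq) gX≡xs , gY≡ys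

-- Counting distinct labels

count : ℕ → List ℕ → ℕ
count b l = length (filterᵇ (_≡ᵇ b) l)

length-binOf : ∀ b (Z : List (A × ℕ)) → length (binOf b Z) ≡ count b (labels Z)
length-binOf b []            = refl
length-binOf b ((_ , c) ∷ Z) with c ≡ᵇ b
... | true  = cong suc (length-binOf b Z)
... | false = length-binOf b Z

count-∷ : ∀ b c l → count b l ≤ count b (c ∷ l)
count-∷ b c l with c ≡ᵇ b
... | true  = ℕ.n≤1+n _
... | false = ℕ.≤-refl

-- does (b ≟ c) reduces to b ≡ᵇ c, so proof (b ≟ c) tells which case of the boolean holds.
count-∷-self : ∀ b l → count b (b ∷ l) ≡ suc (count b l)
count-∷-self b l with b ≡ᵇ b | proof (b ≟ b)
... | true  | _       = refl
... | false | ofⁿ b≢b = ⊥-elim (b≢b refl)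

count-none : All (_≢ b) l → count b l ≡ 0
count-none {b} l∌b =
  cong length (List.filter-none (T? ∘ (_≡ᵇ b)) (All.map (λ c≢b → c≢b ∘ ℕ.≡ᵇ⇒≡ _ b) l∌b))

count-unique : Unique l → count b l ≤ 1
count-unique {[]}        _           = z≤n
count-unique {c ∷ l} {b} (c∉l ∷ l!) with c ≡ᵇ b | proof (c ≟ b)
... | false | _        = count-unique l!
... | true  | ofʸ refl = s≤s (ℕ.≤-reflexive (count-none (All.map ≢-sym c∉l)))

sum-map-mono : ∀ {f g : ℕ → ℕ} → (∀ d → f d ≤ g d) → ∀ Ds → sum (map f Ds) ≤ sum (map g Ds)
sum-map-mono f≤g []       = z≤n
sum-map-mono f≤g (d ∷ Ds) = ℕ.+-mono-≤ (f≤g d) (sum-map-mono f≤g Ds)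

sum-map-bounded : ∀ {f : ℕ → ℕ} {k} → (∀ d → f d ≤ k) → ∀ Ds → sum (map f Ds) ≤ length Ds * k
sum-map-bounded f≤k []       = z≤n
sum-map-bounded f≤k (d ∷ Ds) = ℕ.+-mono-≤ (f≤k d) (sum-map-bounded f≤k Ds)

Σcount : List ℕ → List ℕ → ℕ
Σcount Ds l = sum (map (λ d → count d l) Ds)

Σcount-∷ : ∀ {c} → c ∈ Ds → suc (Σcount Ds l) ≤ Σcount Ds (c ∷ l)
Σcount-∷ {d ∷ Ds} {l} (here refl) =
  ℕ.+-mono-≤ (ℕ.≤-reflexive (sym (count-∷-self d l))) (sum-map-mono (λ e → count-∷ e d l) Ds)
Σcount-∷ {d ∷ Ds} {l} {c} (there c∈Ds) = begin
  suc (count d l + Σcount Ds l)  ≡⟨ ℕ.+-suc (count d l) _ ⟨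
  count d l + suc (Σcount Ds l)  ≤⟨ ℕ.+-mono-≤ (count-∷ d c l) (Σcount-∷ c∈Ds) ⟩
  Σcount (d ∷ Ds) (c ∷ l)        ∎
  where open ℕ.≤-Reasoning

length≤Σcount : All (_∈ Ds) l → length l ≤ Σcount Ds l
length≤Σcount []            = z≤n
length≤Σcount (c∈Ds ∷ l⊆Ds) = ℕ.≤-trans (s≤s (length≤Σcount l⊆Ds)) (Σcount-∷ c∈Ds)

length≤nonEmptyBins*k : ∀ {k} l → (∀ b → count b l ≤ k) → length l ≤ nonEmptyBins l * k
length≤nonEmptyBins*k l count≤k = ℕ.≤-trans
  (length≤Σcount {l = l} (All.tabulate (∈-deduplicate⁺ _≟_)))
  (sum-map-bounded count≤k (deduplicate _≟_ l))

nonEmptyBins≤length : All (_∈ Ds) l → nonEmptyBins l ≤ length Ds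
nonEmptyBins≤length {Ds} {l} l⊆Ds = begin
  nonEmptyBins l                 ≤⟨ length≤Σcount bins⊆Ds ⟩
  Σcount Ds (deduplicate _≟_ l)  ≤⟨ sum-map-bounded (λ _ → count-unique (deduplicate-! _≟_ l)) Ds ⟩
  length Ds * 1                  ≡⟨ ℕ.*-identityʳ _ ⟩
  length Ds                      ∎
  where
  open ℕ.≤-Reasoning
  bins⊆Ds : All (_∈ Ds) (deduplicate _≟_ l)
  bins⊆Ds = All.tabulate (λ b∈bins → All.lookup l⊆Ds (∈-deduplicate⁻ _≟_ l b∈bins))

length≤nonEmptyBins-labels*k : ∀ {k} (Z : List (A × ℕ)) → (∀ b → length (binOf b Z) ≤ k) →
                               length Z ≤ nonEmptyBins (labels Z) * k
length≤nonEmptyBins-labels*k {k = k} Z bin≤k =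
  subst (_≤ nonEmptyBins (labels Z) * k) (List.length-map proj₂ Z)
    (length≤nonEmptyBins*k (labels Z) (λ b → subst (_≤ k) (length-binOf b Z) (bin≤k b)))

-- Label changes and 1-bounded-space algorithms

changes : List ℕ → ℕ
changes []          = 0
changes (_ ∷ [])    = 0
changes (a ∷ b ∷ l) = (if a ≡ᵇ b then 0 else 1) + changes (b ∷ l)

changes-∷-∷ : ∀ a l → changes (a ∷ a ∷ l) ≡ changes (a ∷ l)
changes-∷-∷ a l with a ≡ᵇ a | proof (a ≟ a)
... | true  | _       = refl
... | false | ofⁿ a≢a = ⊥-elim (a≢a refl)

changes-∷-≢ : ∀ {a b} l → a ≢ b → changes (a ∷ b ∷ l) ≡ suc (changes (b ∷ l))
changes-∷-≢ {a} {b} l a≢b with a ≡ᵇ b | proof (a ≟ b)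
... | false | _        = refl
... | true  | ofʸ a≡b = ⊥-elim (a≢b a≡b)

changes-∷ : ∀ a l → changes l ≤ changes (a ∷ l)
changes-∷ a []      = z≤n
changes-∷ a (b ∷ l) = ℕ.m≤n+m _ _

changes-++ : ∀ l l′ → changes l + changes l′ ≤ changes (l ++ l′)
changes-++ []          l′ = ℕ.≤-refl
changes-++ (a ∷ [])    l′ = changes-∷ a l′
changes-++ (a ∷ b ∷ l) l′ =
  ℕ.≤-trans (ℕ.≤-reflexive (ℕ.+-assoc (if a ≡ᵇ b then 0 else 1) _ _))
            (ℕ.+-monoʳ-≤ _ (changes-++ (b ∷ l) l′))

deduplicate-∷-∷ : ∀ a l → deduplicate _≟_ (a ∷ a ∷ l) ≡ deduplicate _≟_ (a ∷ l)
deduplicate-∷-∷ a l = cong (a ∷_)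
  (trans (List.filter-reject (¬? ∘ (a ≟_)) (λ a≢a → a≢a refl))
         (List.filter-idem (¬? ∘ (a ≟_)) (deduplicate _≟_ l)))

nonEmptyBins≤suc-changes : ∀ l → nonEmptyBins l ≤ suc (changes l)
nonEmptyBins≤suc-changes []          = z≤n
nonEmptyBins≤suc-changes (_ ∷ [])    = ℕ.≤-refl
nonEmptyBins≤suc-changes (a ∷ b ∷ l) with nonEmptyBins≤suc-changes (b ∷ l) | a ≟ b
... | ih | yes refl = begin
  nonEmptyBins (a ∷ a ∷ l)   ≡⟨ cong length (deduplicate-∷-∷ a l) ⟩
  nonEmptyBins (a ∷ l)       ≤⟨ ih ⟩
  suc (changes (a ∷ l))      ≡⟨ cong suc (changes-∷-∷ a l) ⟨
  suc (changes (a ∷ a ∷ l))  ∎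
  where open ℕ.≤-Reasoning
... | ih | no a≢b = begin
  nonEmptyBins (a ∷ b ∷ l)                                       ≡⟨⟩
  suc (length (filter (¬? ∘ (a ≟_)) (deduplicate _≟_ (b ∷ l))))  ≤⟨ s≤s (List.length-filter a≢? _) ⟩
  suc (nonEmptyBins (b ∷ l))                                     ≤⟨ s≤s ih ⟩
  suc (suc (changes (b ∷ l)))                                    ≡⟨ cong suc (changes-∷-≢ l a≢b) ⟨
  suc (changes (a ∷ b ∷ l))                                      ∎
  where
  open ℕ.≤-Reasoning
  a≢? = ¬? ∘ (a ≟_)

data Staircase : ℕ → List ℕ → Set where
  []    : Staircase b []
  stay  : Staircase b l → Staircase b (b ∷ l)
  climb : Staircase (suc b) l → Staircase b (suc b ∷ l)

Staircase-≥ : Staircase b l → All (b ≤_) l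
Staircase-≥ []        = []
Staircase-≥ (stay s)  = ℕ.≤-refl ∷ Staircase-≥ s
Staircase-≥ (climb s) = ℕ.n≤1+n _ ∷ All.map ℕ.<⇒≤ (Staircase-≥ s)

nonEmptyBins-staircase : Staircase b l → nonEmptyBins (b ∷ l) ≡ suc (changes (b ∷ l))
nonEmptyBins-staircase []                    = refl
nonEmptyBins-staircase {b} {_ ∷ l} (stay s)  = begin
  nonEmptyBins (b ∷ b ∷ l)    ≡⟨ cong length (deduplicate-∷-∷ b l) ⟩
  nonEmptyBins (b ∷ l)        ≡⟨ nonEmptyBins-staircase s ⟩
  suc (changes (b ∷ l))       ≡⟨ cong suc (changes-∷-∷ b l) ⟨
  suc (changes (b ∷ b ∷ l))   ∎
  where open ≡-Reasoning
nonEmptyBins-staircase {b} {_ ∷ l} (climb s) = begin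
  nonEmptyBins (b ∷ suc b ∷ l)                                       ≡⟨⟩
  suc (length (filter (¬? ∘ (b ≟_)) (deduplicate _≟_ (suc b ∷ l))))
                                       ≡⟨ cong (suc ∘ length) (List.filter-all b≢? above) ⟩
  suc (nonEmptyBins (suc b ∷ l))       ≡⟨ cong suc (nonEmptyBins-staircase s) ⟩
  suc (suc (changes (suc b ∷ l)))      ≡⟨ cong suc (changes-∷-≢ l (ℕ.<⇒≢ (ℕ.n<1+n b))) ⟨
  suc (changes (b ∷ suc b ∷ l))        ∎
  where
  open ≡-Reasoning
  b≢? = ¬? ∘ (b ≟_)
  above = All.deduplicate⁺ _≟_ (All.map ℕ.<⇒≢ (ℕ.≤-refl ∷ Staircase-≥ s))

runAlg-staircase : ∀ Alg h b xs → Staircase b (runAlg Alg h b xs)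
runAlg-staircase Alg h b []       = []
runAlg-staircase Alg h b (x ∷ xs) with Alg h x
... | true  = climb (runAlg-staircase Alg (h ++ [ x ]) (suc b) xs)
... | false = stay  (runAlg-staircase Alg (h ++ [ x ]) b xs)

ALG≡suc-changes : ∀ Alg x xs → ALG Alg (x ∷ xs) ≡ suc (changes (algAssign Alg (x ∷ xs)))
ALG≡suc-changes Alg x xs = nonEmptyBins-staircase (runAlg-staircase Alg [ x ] 0 xs)

-- Packings with natural-number sizes

Fits : ℕ → ℕ → List ℕ → Set
Fits D k ns = sum ns ≤ D × length ns ≤ k

Packing : ℕ → ℕ → List (ℕ × ℕ) → Set
Packing D k Z = ∀ b → Fits D k (binOf b Z)

Fits-++⁻ : ∀ {D k} xs {ys} → Fits D k (xs ++ ys) → Fits D k xs × Fits D k ys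
Fits-++⁻ xs {ys} (sum≤D , length≤k) =
  (ℕ.m+n≤o⇒m≤o _ sum≤D′ , ℕ.m+n≤o⇒m≤o _ length≤k′) ,
  (ℕ.m+n≤o⇒n≤o _ sum≤D′ , ℕ.m+n≤o⇒n≤o _ length≤k′)
  where
  sum≤D′    = subst (_≤ _) (sum-++ xs ys) sum≤D
  length≤k′ = subst (_≤ _) (List.length-++ xs) length≤k

Packing-++⁻ : ∀ {D k} X {Y} → Packing D k (X ++ Y) → Packing D k X × Packing D k Y
Packing-++⁻ {D} {k} X {Y} P = proj₁ ∘ split , proj₂ ∘ split
  where
  split : ∀ b → Fits D k (binOf b X) × Fits D k (binOf b Y)
  split b = Fits-++⁻ (binOf b X) (subst (Fits D k) (binOf-++ b X Y) (P b))

Packing-↭ : ∀ {D k Z Z′} → Z ↭ Z′ → Packing D k Z → Packing D k Z′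
Packing-↭ Z↭Z′ P b = subst (_≤ _) (sum-↭ (binOf-↭ b Z↭Z′)) (proj₁ (P b))
                   , subst (_≤ _) (↭-length (binOf-↭ b Z↭Z′)) (proj₂ (P b))

Packing-++-bin : ∀ {j D k S Z} → All (λ z → proj₂ z ≡ j) S → Fits D k (sizes S) →
                 All (λ z → proj₂ z ≢ j) Z → Packing D k Z → Packing D k (S ++ Z)
Packing-++-bin {j} {D} {k} {S} {Z} S⊆j S-fits Z∌j P b with b ≟ j
... | yes refl = subst (Fits D k) (sym (begin
  binOf b (S ++ Z)        ≡⟨ binOf-++ b S Z ⟩
  binOf b S ++ binOf b Z  ≡⟨ cong₂ _++_ (binOf-all S⊆j) (binOf-none Z∌j) ⟩
  sizes S ++ []           ≡⟨ List.++-identityʳ (sizes S) ⟩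
  sizes S                 ∎)) S-fits
  where open ≡-Reasoning
... | no b≢j = subst (Fits D k) (sym (begin
  binOf b (S ++ Z)        ≡⟨ binOf-++ b S Z ⟩
  binOf b S ++ binOf b Z  ≡⟨ cong (_++ binOf b Z) (binOf-none S∌b) ⟩
  binOf b Z               ∎)) (P b)
  where
  open ≡-Reasoning
  S∌b = All.map (λ c≡j c≡b → b≢j (trans (sym c≡b) c≡j)) S⊆j

Packing-sizes≤ : ∀ {D k Z} → Packing D k Z → All (λ z → proj₁ z ≤ D) Z
Packing-sizes≤ {Z = []}              P = []
Packing-sizes≤ {D} {Z = (a , c) ∷ Z} P = a≤D ∷ Packing-sizes≤ (proj₂ (Packing-++⁻ [ (a , c) ] P))
  where
  a≤D : a ≤ D
  a≤D = ℕ.≤-trans (ℕ.m≤m+n a 0) (subst (λ ns → sum ns ≤ D) (binOf-all {b = c} (refl ∷ []))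
                                  (proj₁ (proj₁ (Packing-++⁻ [ (a , c) ] P) c)))

Overflowing : ℕ → List ℕ → Set
Overflowing D = Linked (λ a a′ → D < a + a′)

overflowing⇒length≤suc-changes : ∀ {D k Z} → Packing D k Z → Overflowing D (sizes Z) →
                                 length Z ≤ suc (changes (labels Z))
overflowing⇒length≤suc-changes {Z = []}     _ _ = z≤n
overflowing⇒length≤suc-changes {Z = _ ∷ []} _ _ = ℕ.≤-refl
overflowing⇒length≤suc-changes {D} {Z = (a , c) ∷ (a′ , c′) ∷ Z} P (D<a+a′ ∷ overflowing)
  with c ≟ c′
... | yes refl = ⊥-elim (ℕ.<⇒≱ D<a+a′ a+a′≤D)
  where
  a+a′≤D : a + a′ ≤ D
  a+a′≤D = subst (_≤ D)
    (trans (cong sum (binOf-all {b = c} (refl ∷ refl ∷ []))) (cong (a +_) (ℕ.+-identityʳ a′)))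
    (proj₁ (proj₁ (Packing-++⁻ ((a , c) ∷ (a′ , c) ∷ []) P) c))
... | no c≢c′ = begin
  suc (length ((a′ , c′) ∷ Z))         ≤⟨ s≤s (overflowing⇒length≤suc-changes P′ overflowing) ⟩
  suc (suc (changes (c′ ∷ labels Z)))  ≡⟨ cong suc (changes-∷-≢ (labels Z) c≢c′) ⟨
  suc (changes (c ∷ c′ ∷ labels Z))    ∎
  where
  open ℕ.≤-Reasoning
  P′ = proj₂ (Packing-++⁻ [ (a , c) ] P)

length≤suc-changes*k : ∀ {D k Z} → Packing D k Z → length Z ≤ suc (changes (labels Z)) * k
length≤suc-changes*k {k = k} {Z} P = ℕ.≤-trans (length≤nonEmptyBins-labels*k Z (proj₂ ∘ P))
  (ℕ.*-monoˡ-≤ k (nonEmptyBins≤suc-changes (labels Z)))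

overflowing++-length-bound : ∀ {D k} Z {xs ys} → Packing D k Z → sizes Z ≡ xs ++ ys →
                             Overflowing D xs →
                             length xs * k + length ys ≤ suc (suc (changes (labels Z))) * k
overflowing++-length-bound {D} {k} Z {xs} {ys} P Z-sizes overflowing
  with map-++⁻ proj₁ Z {xs} {ys} Z-sizes
... | X , Y , refl , refl , refl = begin
  length (sizes X) * k + length (sizes Y)
    ≡⟨ cong₂ (λ a b → a * k + b) (List.length-map proj₁ X) (List.length-map proj₁ Y) ⟩
  length X * k + length Y
    ≤⟨ ℕ.+-mono-≤ (ℕ.*-monoˡ-≤ k (overflowing⇒length≤suc-changes PX overflowing))
                  (length≤suc-changes*k {Z = Y} PY) ⟩
  suc cX * k + suc cY * k                    ≡⟨ ℕ.*-distribʳ-+ k (suc cX) (suc cY) ⟨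
  (suc cX + suc cY) * k                      ≡⟨ cong (λ c → suc c * k) (ℕ.+-suc cX cY) ⟩
  suc (suc (cX + cY)) * k                    ≤⟨ ℕ.*-monoˡ-≤ k (s≤s (s≤s cX+cY≤c)) ⟩
  suc (suc (changes (labels (X ++ Y)))) * k  ∎
  where
  open ℕ.≤-Reasoning
  PX : Packing D k X
  PX = proj₁ (Packing-++⁻ X P)
  PY : Packing D k Y
  PY = proj₂ (Packing-++⁻ X P)
  cX = changes (labels X)
  cY = changes (labels Y)
  cX+cY≤c : cX + cY ≤ changes (labels (X ++ Y))
  cX+cY≤c = subst (λ l → cX + cY ≤ changes l) (sym (List.map-++ proj₂ X Y))
                  (changes-++ (labels X) (labels Y))

-- Rational sizes n / D

_÷_ : ℕ → (D : ℕ) → .{{NonZero D}} → ℚ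
n ÷ D = ℤ.+ n ℚ./ D

toℚᵘ-÷ : ∀ {D} .{{_ : NonZero D}} n → toℚᵘ (n ÷ D) ℚᵘ.≃ mkℚᵘ (ℤ.+ n) (pred D)
toℚᵘ-÷ {suc d} n = ℚ.toℚᵘ-fromℚᵘ (mkℚᵘ (ℤ.+ n) d)

÷-+ : ∀ {D} .{{_ : NonZero D}} m n → m ÷ D ℚ.+ n ÷ D ≡ (m + n) ÷ D
÷-+ {D@(suc d)} m n = ℚ.toℚᵘ-injective (begin
  toℚᵘ (m ÷ D ℚ.+ n ÷ D)              ≈⟨ ℚ.toℚᵘ-homo-+ (m ÷ D) (n ÷ D) ⟩
  toℚᵘ (m ÷ D) ℚᵘ.+ toℚᵘ (n ÷ D)      ≈⟨ ℚᵘ.+-cong (toℚᵘ-÷ m) (toℚᵘ-÷ n) ⟩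
  mkℚᵘ (ℤ.+ m) d ℚᵘ.+ mkℚᵘ (ℤ.+ n) d  ≈⟨ *≡* common-denominator ⟩
  mkℚᵘ (ℤ.+ (m + n)) d                ≈⟨ toℚᵘ-÷ (m + n) ⟨
  toℚᵘ ((m + n) ÷ D)                  ∎)
  where
  open ℚᵘ.≃-Reasoning
  ℤ-identity : ∀ x y z → (x ℤ.* z ℤ.+ y ℤ.* z) ℤ.* z ≡ (x ℤ.+ y) ℤ.* (z ℤ.* z)
  ℤ-identity = ℤ.solve-∀
  common-denominator : (ℤ.+ m ℤ.* ℤ.+ D ℤ.+ ℤ.+ n ℤ.* ℤ.+ D) ℤ.* ℤ.+ D
                     ≡ ℤ.+ (m + n) ℤ.* ℤ.+ (D * D)
  common-denominator = trans (ℤ-identity (ℤ.+ m) (ℤ.+ n) (ℤ.+ D))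
    (sym (cong₂ ℤ._*_ (ℤ.pos-+ m n) (ℤ.pos-* D D)))

sumℚ-÷ : ∀ {D} .{{_ : NonZero D}} ns → sumℚ (map (_÷ D) ns) ≡ sum ns ÷ D
sumℚ-÷ {D} []       = sym (ℚ.0/n≡0 D)
sumℚ-÷ {D} (n ∷ ns) = trans (cong (n ÷ D ℚ.+_) (sumℚ-÷ ns)) (÷-+ n (sum ns))

÷≤1⇔ : ∀ {D} .{{_ : NonZero D}} n → n ÷ D ℚ.≤ 1ℚ ⇔ n ≤ D
÷≤1⇔ {D@(suc d)} n = mk⇔
  (λ n÷D≤1 → unscale (ℚᵘ.≤-respˡ-≃ (toℚᵘ-÷ n) (ℚ.toℚᵘ-mono-≤ n÷D≤1)))
  (λ n≤D → ℚ.toℚᵘ-cancel-≤ (ℚᵘ.≤-respˡ-≃ (ℚᵘ.≃-sym (toℚᵘ-÷ n)) (scale n≤D)))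
  where
  unscale : mkℚᵘ (ℤ.+ n) d ℚᵘ.≤ ℚᵘ.1ℚᵘ → n ≤ D
  unscale (*≤* le) =
    ℤ.drop‿+≤+ (subst₂ ℤ._≤_ (ℤ.*-identityʳ (ℤ.+ n)) (ℤ.*-identityˡ (ℤ.+ D)) le)
  scale : n ≤ D → mkℚᵘ (ℤ.+ n) d ℚᵘ.≤ ℚᵘ.1ℚᵘ
  scale le =
    *≤* (subst₂ ℤ._≤_ (sym (ℤ.*-identityʳ (ℤ.+ n))) (sym (ℤ.*-identityˡ (ℤ.+ D))) (ℤ.+≤+ le))

0<÷ : ∀ {D} .{{_ : NonZero D}} n → 0ℚ ℚ.< suc n ÷ D
0<÷ {D} n = ℚ.positive⁻¹ (suc n ÷ D) {{ℚ.normalize-pos (suc n) D}}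

Fits⇔ : ∀ {D k} .{{_ : NonZero D}} ns →
        Fits D k ns ⇔ (sumℚ (map (_÷ D) ns) ℚ.≤ 1ℚ × length (map (_÷ D) ns) ≤ k)
Fits⇔ {D} {k} ns = mk⇔
  (λ (sum≤D , length≤k) →
      subst (ℚ._≤ 1ℚ) (sym (sumℚ-÷ ns)) (Equivalence.from (÷≤1⇔ (sum ns)) sum≤D)
    , subst (_≤ k) (sym (List.length-map (_÷ D) ns)) length≤k)
  (λ (sum≤1 , length≤k) →
      Equivalence.to (÷≤1⇔ (sum ns)) (subst (ℚ._≤ 1ℚ) (sumℚ-÷ ns) sum≤1)
    , subst (_≤ k) (List.length-map (_÷ D) ns) length≤k)

Feasible⇒Packing : ∀ {D k} .{{_ : NonZero D}} N f →
                   Feasible k (map (_÷ D) N) f → Packing D k (zip N f)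
Feasible⇒Packing {D} {k} N f (_ , fits) b = Equivalence.from (Fits⇔ (binOf b (zip N f)))
  (subst (λ qs → sumℚ qs ℚ.≤ 1ℚ × length qs ≤ k) (binOf-zip-map (_÷ D) b N f) (fits b))

Packing⇒Feasible : ∀ {D k} .{{_ : NonZero D}} Z →
                   Packing D k Z → Feasible k (map (_÷ D) (sizes Z)) (labels Z)
Packing⇒Feasible {D} {k} Z P = equal-lengths , fits
  where
  I = map (_÷ D) (sizes Z)
  equal-lengths : length (labels Z) ≡ length I
  equal-lengths = trans (List.length-map proj₂ Z)
    (sym (trans (List.length-map (_÷ D) (sizes Z)) (List.length-map proj₁ Z)))
  bin-÷ : ∀ b → binOf b (zip I (labels Z)) ≡ map (_÷ D) (binOf b Z)
  bin-÷ b = trans (binOf-zip-map (_÷ D) b (sizes Z) (labels Z))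
                  (cong (map (_÷ D) ∘ binOf b) (zip-sizes-labels Z))
  fits : ∀ b → sumℚ (binOf b (zip I (labels Z))) ℚ.≤ 1ℚ × length (binOf b (zip I (labels Z))) ≤ k
  fits b = subst (λ qs → sumℚ qs ℚ.≤ 1ℚ × length qs ≤ k) (sym (bin-÷ b))
    (Equivalence.to (Fits⇔ (binOf b Z)) (P b))

ValidInput-÷ : ∀ {D} .{{_ : NonZero D}} N → All (λ n → 0 < n × n ≤ D) N → ValidInput (map (_÷ D) N)
ValidInput-÷ []          []                 = tt
ValidInput-÷ (suc n ∷ N) ((_ , 1+n≤D) ∷ ok) =
  0<÷ n , Equivalence.from (÷≤1⇔ (suc n)) 1+n≤D , ValidInput-÷ N ok

-- The adversarial input

module Construction (k′ m₁ : ℕ) where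

  k m s D : ℕ
  k = 2 + k′
  m = suc m₁
  s = suc k′
  D = k + (m + m) * s

  large medium : ℕ → ℕ
  large  j = suc ((m + j) * s)
  medium j = suc ((m ∸ j) * s)

  optimalBin : ℕ → List (ℕ × ℕ)
  optimalBin j = (large j , j) ∷ (medium j , j) ∷ replicate k′ (1 , j)

  optimal : ℕ → ℕ → List (ℕ × ℕ)
  optimal j zero    = []
  optimal j (suc n) = optimalBin j ++ optimal (suc j) n

  pairs : ℕ → ℕ → List (ℕ × ℕ)
  pairs j zero    = []
  pairs j (suc n) = (large j , j) ∷ (medium j , j) ∷ pairs (suc j) n

  chain : ℕ → ℕ → List (ℕ × ℕ)
  chain j zero    = []
  chain j (suc n) = (large (suc j) , suc j) ∷ (medium j , j) ∷ chain (suc j) n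

  tiny : ℕ → ℕ → List (ℕ × ℕ)
  tiny j zero    = []
  tiny j (suc n) = replicate k′ (1 , j) ++ tiny (suc j) n

  front back input : List (ℕ × ℕ)
  front = (large 0 , 0) ∷ chain 0 m₁
  back  = (medium m₁ , m₁) ∷ tiny 0 m
  input = front ++ back

  chain-↭ : ∀ j n → (large j , j) ∷ chain j n ++ [ (medium (j + n) , j + n) ] ↭ pairs j (suc n)
  chain-↭ j zero    rewrite ℕ.+-identityʳ j = ↭-refl
  chain-↭ j (suc n) rewrite ℕ.+-suc j n     =
    prep _ (↭-trans (swap _ _ ↭-refl) (prep _ (chain-↭ (suc j) n)))

  pairs-tiny-↭ : ∀ j n → pairs j n ++ tiny j n ↭ optimal j n
  pairs-tiny-↭ j zero    = ↭-refl
  pairs-tiny-↭ j (suc n) = prep _ (prep _ (↭-trans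
    (shifts (pairs (suc j) n) (replicate k′ (1 , j)))
    (++⁺ˡ (replicate k′ (1 , j)) (pairs-tiny-↭ (suc j) n))))

  input-↭ : input ↭ optimal 0 m
  input-↭ = begin
    front ++ (medium m₁ , m₁) ∷ tiny 0 m         ≡⟨ List.++-assoc front [ (medium m₁ , m₁) ] _ ⟨
    (front ++ [ (medium m₁ , m₁) ]) ++ tiny 0 m  ↭⟨ ++⁺ʳ (tiny 0 m) (chain-↭ 0 m₁) ⟩
    pairs 0 m ++ tiny 0 m                        ↭⟨ pairs-tiny-↭ 0 m ⟩
    optimal 0 m                                  ∎
    where open PermutationReasoning

  optimalBin-labels : ∀ j → All (λ z → proj₂ z ≡ j) (optimalBin j)
  optimalBin-labels j = refl ∷ refl ∷ All.replicate⁺ k′ refl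

  optimalBin-fits : ∀ {j} → j ≤ m → Fits D k (sizes (optimalBin j))
  optimalBin-fits {j} j≤m = ℕ.≤-reflexive sum≡D , ℕ.≤-reflexive (cong (2 +_) length-tiny)
    where
    length-tiny : length (sizes (replicate k′ (1 , j))) ≡ k′
    length-tiny = trans (List.length-map proj₁ (replicate k′ (1 , j))) (List.length-replicate k′)
    sum-tiny : ∀ n → sum (sizes (replicate n (1 , j))) ≡ n
    sum-tiny zero    = refl
    sum-tiny (suc n) = cong suc (sum-tiny n)
    weights : ∀ t x y → suc (x * suc t) + (suc (y * suc t) + t) ≡ (2 + t) + (x + y) * suc t
    weights = solve-∀
    sum≡D : sum (sizes (optimalBin j)) ≡ D
    sum≡D = begin
      large j + (medium j + sum (sizes (replicate k′ (1 , j))))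
        ≡⟨ cong (λ t → large j + (medium j + t)) (sum-tiny k′) ⟩
      large j + (medium j + k′)
        ≡⟨ weights k′ (m + j) (m ∸ j) ⟩
      k + ((m + j) + (m ∸ j)) * s
        ≡⟨ cong (λ w → k + w * s) (trans (ℕ.+-assoc m j _) (cong (m +_) (ℕ.m+[n∸m]≡n j≤m))) ⟩
      D ∎
      where open ≡-Reasoning

  optimal-labels : ∀ j n → All (λ z → j ≤ proj₂ z × proj₂ z < j + n) (optimal j n)
  optimal-labels j zero    = []
  optimal-labels j (suc n) = All.++⁺
    (All.map (λ { refl → ℕ.≤-refl , ℕ.m<m+n j z<s }) (optimalBin-labels j))
    (All.map (λ {z} (j<c , c<1+j+n) → ℕ.<⇒≤ j<c , subst (proj₂ z <_) (sym (ℕ.+-suc j n)) c<1+j+n)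
             (optimal-labels (suc j) n))

  optimal-positive : ∀ j n → All (λ z → 0 < proj₁ z) (optimal j n)
  optimal-positive j zero    = []
  optimal-positive j (suc n) =
    All.++⁺ (z<s ∷ z<s ∷ All.replicate⁺ k′ z<s) (optimal-positive (suc j) n)

  optimal-packing : ∀ j n → j + n ≤ m → Packing D k (optimal j n)
  optimal-packing j zero    _       b = z≤n , z≤n
  optimal-packing j (suc n) j+1+n≤m   = Packing-++-bin (optimalBin-labels j)
    (optimalBin-fits (ℕ.m+n≤o⇒m≤o j j+1+n≤m))
    (All.map (λ (j<c , _) → ℕ.>⇒≢ j<c) (optimal-labels (suc j) n))
    (optimal-packing (suc j) n (subst (_≤ m) (ℕ.+-suc j n) j+1+n≤m))

  input-packing : Packing D k input
  input-packing = Packing-↭ (↭-sym input-↭) (optimal-packing 0 m ℕ.≤-refl)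

  input-labels : All (_∈ upTo m) (labels input)
  input-labels = All.map⁺
    (All-resp-↭ (↭-sym input-↭) (All.map (∈-upTo⁺ ∘ proj₂) (optimal-labels 0 m)))

  input-sizes : All (λ n → 0 < n × n ≤ D) (sizes input)
  input-sizes = All.map⁺
    (All.zip (All-resp-↭ (↭-sym input-↭) (optimal-positive 0 m) , Packing-sizes≤ input-packing))

  overflow : ∀ x y → m + m < x + y → D < suc (x * s) + suc (y * s)
  overflow x y m+m<x+y = begin
    suc D                      ≡⟨ e₁ k′ (m + m) ⟩
    2 + suc (m + m) * s        ≤⟨ ℕ.+-monoʳ-≤ 2 (ℕ.*-monoˡ-≤ s m+m<x+y) ⟩
    2 + (x + y) * s            ≡⟨ e₂ k′ x y ⟩
    suc (x * s) + suc (y * s)  ∎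
    where
    open ℕ.≤-Reasoning
    e₁ : ∀ t w → suc ((2 + t) + w * suc t) ≡ 2 + suc w * suc t
    e₁ = solve-∀
    e₂ : ∀ t x y → 2 + (x + y) * suc t ≡ suc (x * suc t) + suc (y * suc t)
    e₂ = solve-∀

  weight-gap : ∀ i j → j ≤ i → m + m < m + suc i + (m ∸ j)
  weight-gap i j j≤i = begin-strict
    m + m                    ≤⟨ ℕ.+-monoʳ-≤ m (ℕ.m≤n+m∸n m j) ⟩
    m + (j + (m ∸ j))        ≤⟨ ℕ.+-monoʳ-≤ m (ℕ.+-monoˡ-≤ (m ∸ j) j≤i) ⟩
    m + (i + (m ∸ j))        <⟨ ℕ.n<1+n _ ⟩
    suc (m + (i + (m ∸ j)))  ≡⟨ e m i (m ∸ j) ⟩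
    m + suc i + (m ∸ j)      ∎
    where
    open ℕ.≤-Reasoning
    e : ∀ a b c → suc (a + (b + c)) ≡ a + suc b + c
    e = solve-∀

  chain-overflowing : ∀ j n {a} → D < a + large (suc j) → Overflowing D (a ∷ sizes (chain j n))
  chain-overflowing j zero    _         = [-]
  chain-overflowing j (suc n) D<a+large =
    D<a+large ∷ overflow (m + suc j) (m ∸ j) (weight-gap j j ℕ.≤-refl)
              ∷ chain-overflowing (suc j) n (overflow (m ∸ j) (m + suc (suc j)) gap)
    where
    gap : m + m < (m ∸ j) + (m + suc (suc j))
    gap = subst (m + m <_) (ℕ.+-comm (m + suc (suc j)) (m ∸ j)) (weight-gap (suc j) j (ℕ.n≤1+n j))

  front-overflowing : Overflowing D (sizes front)
  front-overflowing = chain-overflowing 0 m₁ (overflow (m + 0) (m + 1) gap)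
    where
    e : ∀ a → a + 1 + a ≡ (a + 0) + (a + 1)
    e = solve-∀
    gap : m + m < (m + 0) + (m + 1)
    gap = subst (m + m <_) (e m) (weight-gap 0 0 z≤n)

  length-chain : ∀ j n → length (chain j n) ≡ n + n
  length-chain j zero    = refl
  length-chain j (suc n) = cong suc (trans (cong suc (length-chain (suc j) n)) (sym (ℕ.+-suc n n)))

  length-tiny : ∀ j n → length (tiny j n) ≡ n * k′
  length-tiny j zero    = refl
  length-tiny j (suc n) = trans (List.length-++ (replicate k′ (1 , j)))
                                (cong₂ _+_ (List.length-replicate k′) (length-tiny (suc j) n))

  length-front : length (sizes front) ≡ suc (m₁ + m₁)
  length-front = trans (List.length-map proj₁ front) (cong suc (length-chain 0 m₁))

  length-back : length (sizes back) ≡ suc (m * k′)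
  length-back = trans (List.length-map proj₁ back) (cong suc (length-tiny 0 m))

  I : List ℚ
  I = map (_÷ D) (sizes input)

  I-valid : ValidInput I
  I-valid = ValidInput-÷ (sizes input) input-sizes

  length-I : length I ≡ m * k
  length-I = begin
    length I                                    ≡⟨ List.length-map (_÷ D) (sizes input) ⟩
    length (sizes input)                        ≡⟨ cong length (List.map-++ proj₁ front back) ⟩
    length (sizes front ++ sizes back)          ≡⟨ List.length-++ (sizes front) ⟩
    length (sizes front) + length (sizes back)  ≡⟨ cong₂ _+_ length-front length-back ⟩
    suc (m₁ + m₁) + suc (m * k′)                ≡⟨ e m₁ k′ ⟩
    m * k                                       ∎
    where
    open ≡-Reasoning
    e : ∀ a t → suc (a + a) + suc (suc a * t) ≡ suc a * (2 + t)
    e = solve-∀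

  OPT-lower : ∀ f → Feasible k I f → m ≤ nonEmptyBins f
  OPT-lower f (length-f , fits) = ℕ.*-cancelʳ-≤ m (nonEmptyBins f) k (begin
    m * k                                ≡⟨ length-I ⟨
    length I                             ≡⟨ length-zip I f (sym length-f) ⟨
    length (zip I f)                     ≤⟨ length≤nonEmptyBins-labels*k (zip I f) (proj₂ ∘ fits) ⟩
    nonEmptyBins (labels (zip I f)) * k  ≡⟨ cong (λ l → nonEmptyBins l * k) labels≡f ⟩
    nonEmptyBins f * k                   ∎)
    where
    open ℕ.≤-Reasoning
    labels≡f = labels-zip I f (sym length-f)

  OPT : OPTis k I m
  OPT = (labels input , feasible , ℕ.≤-antisym bins≤m (OPT-lower (labels input) feasible)) ,
        OPT-lower
    where
    feasible = Packing⇒Feasible input input-packing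
    bins≤m : nonEmptyBins (labels input) ≤ m
    bins≤m = subst (nonEmptyBins (labels input) ≤_) (List.length-upTo m)
                   (nonEmptyBins≤length input-labels)

  ALG-lower : ∀ Alg → KConstrained k Alg → suc (m₁ + m₁) * k + suc (m * k′) ≤ suc (ALG Alg I) * k
  ALG-lower Alg constrained = begin
    suc (m₁ + m₁) * k + suc (m * k′)
      ≡⟨ cong₂ (λ a b → a * k + b) length-front length-back ⟨
    length (sizes front) * k + length (sizes back)
      ≤⟨ overflowing++-length-bound Z P Z-sizes front-overflowing ⟩
    suc (suc (changes (labels Z))) * k
      ≡⟨ cong (λ l → suc (suc (changes l)) * k) (labels-zip (sizes input) f equal-lengths) ⟩
    suc (suc (changes f)) * k
      ≡⟨ cong (λ a → suc a * k) ALG≡ ⟨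
    suc (ALG Alg I) * k ∎
    where
    open ℕ.≤-Reasoning
    f = algAssign Alg I
    ALG≡ : ALG Alg I ≡ suc (changes f)
    ALG≡ = ALG≡suc-changes Alg (large 0 ÷ D) (map (_÷ D) (sizes (chain 0 m₁ ++ back)))
    feasible = constrained I I-valid
    equal-lengths : length (sizes input) ≡ length f
    equal-lengths = sym (trans (proj₁ feasible) (List.length-map (_÷ D) (sizes input)))
    Z = zip (sizes input) f
    P : Packing D k Z
    P = Feasible⇒Packing (sizes input) f feasible
    Z-sizes : sizes Z ≡ sizes front ++ sizes back
    Z-sizes = trans (sizes-zip (sizes input) f equal-lengths) (List.map-++ proj₁ front back)

2[1+m₁]≤x+2 : ∀ k′ m₁ x → suc (m₁ + m₁) * (2 + k′) + suc (suc m₁ * k′) ≤ suc x * (2 + k′) →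
              2 * suc m₁ ≤ x + 2
2[1+m₁]≤x+2 k′ m₁ x bound = begin
  2 * suc m₁   ≡⟨ e m₁ ⟩
  m₁ + m₁ + 2  ≤⟨ ℕ.+-monoˡ-≤ 2 (ℕ.≤-pred (ℕ.*-cancelʳ-≤ _ _ (2 + k′) (ℕ.m+n≤o⇒m≤o _ bound))) ⟩
  x + 2        ∎
  where
  open ℕ.≤-Reasoning
  e : ∀ a → 2 * suc a ≡ a + a + 2
  e = solve-∀

[3k∸2]m+5≤kx+5k : ∀ k′ m₁ x → suc (m₁ + m₁) * (2 + k′) + suc (suc m₁ * k′) ≤ suc x * (2 + k′) →
                  (3 * (2 + k′) ∸ 2) * suc m₁ + 5 ≤ (2 + k′) * x + 5 * (2 + k′)
[3k∸2]m+5≤kx+5k k′ m₁ x bound = begin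
  (3 * (2 + k′) ∸ 2) * suc m₁ + 5
    ≡⟨ cong (λ c → c * suc m₁ + 5) (3k∸2 k′) ⟩
  (4 + 3 * k′) * suc m₁ + 5
    ≤⟨ ℕ.m≤m+n _ (2 + 3 * k′) ⟩
  (4 + 3 * k′) * suc m₁ + 5 + (2 + 3 * k′)
    ≡⟨ e₁ k′ m₁ ⟩
  suc (m₁ + m₁) * (2 + k′) + suc (suc m₁ * k′) + 4 * (2 + k′)
    ≤⟨ ℕ.+-monoˡ-≤ (4 * (2 + k′)) bound ⟩
  suc x * (2 + k′) + 4 * (2 + k′)
    ≡⟨ e₂ k′ x ⟩
  (2 + k′) * x + 5 * (2 + k′) ∎
  where
  open ℕ.≤-Reasoning
  -- The left-hand side is what 3 * (2 + t) ∸ 2 unfolds to.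
  3k∸2 : ∀ t → t + (2 + t + (2 + t + 0)) ≡ 4 + 3 * t
  3k∸2 = solve-∀
  e₁ : ∀ t a → (4 + 3 * t) * suc a + 5 + (2 + 3 * t)
             ≡ suc (a + a) * (2 + t) + suc (suc a * t) + 4 * (2 + t)
  e₁ = solve-∀
  e₂ : ∀ t y → suc y * (2 + t) + 4 * (2 + t) ≡ (2 + t) * y + 5 * (2 + t)
  e₂ = solve-∀

-- Both bounds hold for every k ≥ 2 and m ≥ 1.
theorem14 : (k : ℕ) → 2 ≤ k → (A : OnlineAlg) → KConstrained k A →
    (m : ℕ) → 3 ≤ m →
    Σ (List ℚ) λ I → ValidInput I × OPTis k I m ×
      ((k ≡ 2 → 2 * m ≤ ALG A I + 2) ×
       (3 ≤ k → (3 * k ∸ 2) * m + 5 ≤ k * ALG A I + 5 * k))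
theorem14 (suc (suc k′)) (s≤s (s≤s z≤n)) A constrained (suc m₁) (s≤s _) =
  I , I-valid , OPT , (λ _ → 2[1+m₁]≤x+2 k′ m₁ (ALG A I) bound)
                    , (λ _ → [3k∸2]m+5≤kx+5k k′ m₁ (ALG A I) bound)
  where
  open Construction k′ m₁
  bound = ALG-lower A constrained
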